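{- Let $T_1,T_2$ be decorated trees. If $\mathrm{P}(T_1)=\mathrm{P}(T_2)$ and $\mathrm{Q}(T_1)=\mathrm{Q}(T_2)$, then $T_1=T_2$ (as plane trees with leaf labels).
   Context: Rooted plane trees: children of each vertex are linearly ordered; the root has depth $0$; a leaf is a non-root vertex without children, other vertices are internal; an internal edge is one whose lower endpoint is internal. The traversal is the depth-first traversal from the root visiting children in order; the traversal order of leaves is the order in which it meets them. A decorated tree is a rooted plane tree with an integer label $\geq -1$ on each leaf such that: (1) if a leaf $\ell$ has parent of depth $p$, the label of $\ell$ is $<p$; (2) every internal vertex of depth $p>0$ has a descendant leaf with label $\le p-2$; (3) for any vertex $t$ of depth $p$ and any subtree $T'$ rooted at a child of $t$, if a leaf $\ell$ of $T'$ has label $p$ then every leaf of $T'$ preceding $\ell$ in traversal order has label $\ge p$. $\mathrm{Q}(T)$ is the contour word of $T$: write $u$ each time an edge is traversed away from the root and $d$ each time it is traversed back. $\mathrm{P}(T)$: give each leaf initial charge $0$; for each internal vertex of depth $p>0$, add $1$ to the charge of the first leaf (in traversal order) among its descendants having label $\le p-2$. Then, during the traversal, append $u$ when an internal edge is first visited and $u d^{1+k}$ when a leaf of charge $k$ is first visited; the resulting word is $\mathrm{P}(T)$. -}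

module Defs where

open import Data.Nat using (ℕ; zero; suc)
open import Data.Integer using (ℤ; +_; -[1+_]; _-_; _+_; _≤_; _<_; _≤?_)
open import Data.Bool using (Bool; true; false; if_then_else_)
open import Data.List using (List; []; _∷_; _++_; replicate)
open import Data.List.Relation.Unary.All using (All)
open import Data.List.Relation.Unary.Any using (Any)
open import Data.Product using (_×_; _,_; Σ)
open import Relation.Binary.PropositionalEquality using (_≡_)
open import Relation.Nullary.Decidable using (⌊_⌋)

data Sub : Set where
  leaf : ℤ → Sub
  node : List Sub → Sub

-- A rooted plane tree with leaf labels: the ordered list of subtrees rooted at
-- the children of the root (the root itself is never a leaf).
LTree : Set
LTree = List Sub

mutual
  leavesS : Sub → List ℤ
  leavesS (leaf ℓ) = ℓ ∷ []
  leavesS (node cs) = leavesL cs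

  leavesL : List Sub → List ℤ
  leavesL [] = []
  leavesL (c ∷ cs) = leavesS c ++ leavesL cs

-- Condition (3) for one subtree T' rooted at a child of a vertex of depth p,
-- given the labels of the leaves of T' in traversal order.
PrefixCond : ℤ → List ℤ → Set
PrefixCond p ls = ∀ xs y ys → ls ≡ xs ++ (y ∷ ys) → y ≡ p → All (p ≤_) xs

-- Decoration conditions for a subtree whose root has depth d (d ≥ 1).
mutual
  DecS : ℕ → Sub → Set
  -- leaf: label ≥ -1 and (1) label < depth of parent = d - 1
  DecS d (leaf ℓ) = (-[1+ 0 ] ≤ ℓ) × (ℓ < (+ d) - (+ 1))
  -- internal vertex of depth d > 0: (2), (3) for its children, recursively
  DecS d (node cs) =
    Any (λ ℓ → ℓ ≤ (+ d) - (+ 2)) (leavesL cs) × (All (λ c → PrefixCond (+ d) (leavesS c)) cs × DecL (suc d) cs)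

  DecL : ℕ → List Sub → Set
  DecL d [] = Data.Unit.⊤ where import Data.Unit
  DecL d (c ∷ cs) = DecS d c × DecL d cs

-- A decorated tree: (1)-(3) hold, including (3) at the root (depth 0).
Decorated : LTree → Set
Decorated cs = All (λ c → PrefixCond (+ 0) (leavesS c)) cs × DecL 1 cs

data Letter : Set where
  u d : Letter

mutual
  contourS : Sub → List Letter
  contourS (leaf _) = u ∷ d ∷ []
  contourS (node cs) = u ∷ (contourL cs ++ (d ∷ []))

  contourL : List Sub → List Letter
  contourL [] = []
  contourL (c ∷ cs) = contourS c ++ contourL cs

Q : LTree → List Letter
Q = contourL

-- Trees whose leaves carry (label, charge).
data CSub : Set where
  cleaf : ℤ → ℕ → CSub
  cnode : List CSub → CSub

-- add 1 to the charge of the first leaf (traversal order) whose label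
-- satisfies the predicate; the Bool reports whether such a leaf was found.
mutual
  bumpS : (ℤ → Bool) → CSub → CSub × Bool
  bumpS P (cleaf ℓ k) = if P ℓ then (cleaf ℓ (suc k) , true) else (cleaf ℓ k , false)
  bumpS P (cnode cs) with bumpL P cs
  ... | cs' , b = cnode cs' , b

  bumpL : (ℤ → Bool) → List CSub → List CSub × Bool
  bumpL P [] = [] , false
  bumpL P (c ∷ cs) with bumpS P c
  ... | c' , true = c' ∷ cs , true
  ... | c' , false with bumpL P cs
  ... | cs' , b = c' ∷ cs' , b

-- Charges: for a subtree rooted at depth d, each internal vertex of depth
-- p > 0 adds 1 to the first descendant leaf with label ≤ p - 2.
mutual
  chargeS : ℕ → Sub → CSub
  chargeS p (leaf ℓ) = cleaf ℓ 0
  chargeS p (node cs) with bumpL (λ ℓ → ⌊ ℓ ≤? (+ p) - (+ 2) ⌋) (chargeL (suc p) cs)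
  ... | cs' , _ = cnode cs'

  chargeL : ℕ → List Sub → List CSub
  chargeL p [] = []
  chargeL p (c ∷ cs) = chargeS p c ∷ chargeL p cs

mutual
  pwordS : CSub → List Letter
  pwordS (cleaf _ k) = u ∷ replicate (suc k) d
  pwordS (cnode cs) = u ∷ pwordL cs

  pwordL : List CSub → List Letter
  pwordL [] = []
  pwordL (c ∷ cs) = pwordS c ++ pwordL cs

P : LTree → List Letter
P T = pwordL (chargeL 1 T)

module Submission where

-- Proof strategy.  From Q(T) and P(T) we recover successively the shape of T,
-- the charges of its leaves, and finally its leaf labels.
--
--  1. Condition (2) forbids childless internal vertices; on such trees the
--     contour word Q is injective on shapes (unlabelled plane trees).
--  2. The word P is u d^(1+k) per leaf and u per internal edge, so once the
--     shape is known, P determines the sequence of leaf charges.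
--  3. Dominance: let two decorated trees have the same shape and leaf words
--     which first differ at some leaf, labelled x₁ < x₂.  Going up from that
--     leaf, every charging vertex gives the leaf of the first tree at least as
--     much charge as that of the second, and strictly more once x₂ ≥ 0
--     (conditions (1) and (3) are what make this work).  At the root labels
--     are ≥ -1, so x₂ ≥ 0 and the charge sequences would differ.
--  4. Hence equal P and Q force equal leaf words, and a tree is determined by
--     its shape and its leaf word.
-- Charges are tracked on the flattened list of (label, charge) pairs, where
-- charging a vertex becomes "bump the first eligible entry" (bumpList).

open import Defs
open import Data.Nat as ℕ using (ℕ; zero; suc; z≤n; s≤s)
import Data.Nat.Properties as ℕP
open import Data.Integer as ℤ using (ℤ; +_; -[1+_]; _-_; _≤_; _<_; _≤?_; _≟_)
import Data.Integer.Properties as ℤP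
open import Data.Bool using (Bool; true; false; if_then_else_)
open import Data.Unit using (⊤)
open import Data.Empty using (⊥-elim)
open import Data.Product using (Σ; _×_; _,_; proj₁; proj₂)
open import Data.Sum using (_⊎_; inj₁; inj₂)
open import Data.List using (List; []; _∷_; _++_; map; length; replicate)
open import Data.List.Properties using (++-assoc; ++-identityʳ; map-++; length-map; length-++; ∷-injectiveˡ; ∷-injectiveʳ)
open import Data.List.Relation.Unary.All as All using (All; []; _∷_)
import Data.List.Relation.Unary.All.Properties as AllP
open import Function using (_∘_)
open import Relation.Nullary using (¬_; yes; no)
open import Relation.Nullary.Decidable using (⌊_⌋)
open import Relation.Binary using (tri<; tri≈; tri>)
open import Relation.Binary.PropositionalEquality
open ≡-Reasoning

[]≢++∷ : ∀ {A : Set} (L : List A) {x : A} {R : List A} → ¬ ([] ≡ L ++ x ∷ R)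
[]≢++∷ [] ()
[]≢++∷ (_ ∷ _) ()

++-cancel-length : ∀ {A : Set} (a b : List A) {x y : List A} →
  length a ≡ length b → a ++ x ≡ b ++ y → a ≡ b × x ≡ y
++-cancel-length [] [] _ eq = refl , eq
++-cancel-length (p ∷ a) (q ∷ b) len eq =
  let a≡b , x≡y = ++-cancel-length a b (ℕP.suc-injective len) (∷-injectiveʳ eq)
  in cong₂ _∷_ (∷-injectiveˡ eq) a≡b , x≡y

data Shape : Set where
  sleaf : Shape
  snode : List Shape → Shape

snode-injective : ∀ {ss ts} → snode ss ≡ snode ts → ss ≡ ts
snode-injective refl = refl

mutual
  shapeS : Sub → Shape
  shapeS (leaf _) = sleaf
  shapeS (node cs) = snode (shapeL cs)

  shapeL : List Sub → List Shape
  shapeL [] = []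
  shapeL (c ∷ cs) = shapeS c ∷ shapeL cs

mutual
  cshapeS : CSub → Shape
  cshapeS (cleaf _ _) = sleaf
  cshapeS (cnode cs) = snode (cshapeL cs)

  cshapeL : List CSub → List Shape
  cshapeL [] = []
  cshapeL (c ∷ cs) = cshapeS c ∷ cshapeL cs

mutual
  leafCountS : ∀ c₁ c₂ → shapeS c₁ ≡ shapeS c₂ → length (leavesS c₁) ≡ length (leavesS c₂)
  leafCountS (leaf _) (leaf _) _ = refl
  leafCountS (node cs₁) (node cs₂) sh = leafCountL cs₁ cs₂ (snode-injective sh)

  leafCountL : ∀ cs₁ cs₂ → shapeL cs₁ ≡ shapeL cs₂ → length (leavesL cs₁) ≡ length (leavesL cs₂)
  leafCountL [] [] _ = refl
  leafCountL (c₁ ∷ cs₁) (c₂ ∷ cs₂) sh = begin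
    length (leavesS c₁ ++ leavesL cs₁)                ≡⟨ length-++ (leavesS c₁) ⟩
    length (leavesS c₁) ℕ.+ length (leavesL cs₁)      ≡⟨ cong₂ ℕ._+_ (leafCountS c₁ c₂ (∷-injectiveˡ sh))
                                                                     (leafCountL cs₁ cs₂ (∷-injectiveʳ sh)) ⟩
    length (leavesS c₂) ℕ.+ length (leavesL cs₂)      ≡⟨ length-++ (leavesS c₂) ⟨
    length (leavesS c₂ ++ leavesL cs₂)                ∎

mutual
  sub-determined : ∀ c₁ c₂ → shapeS c₁ ≡ shapeS c₂ → leavesS c₁ ≡ leavesS c₂ → c₁ ≡ c₂
  sub-determined (leaf _) (leaf _) _ eq = cong leaf (∷-injectiveˡ eq)
  sub-determined (node cs₁) (node cs₂) sh eq = cong node (forest-determined cs₁ cs₂ (snode-injective sh) eq)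

  forest-determined : ∀ cs₁ cs₂ → shapeL cs₁ ≡ shapeL cs₂ → leavesL cs₁ ≡ leavesL cs₂ → cs₁ ≡ cs₂
  forest-determined [] [] _ _ = refl
  forest-determined (c₁ ∷ cs₁) (c₂ ∷ cs₂) sh eq =
    let same₁ , same₂ = ++-cancel-length (leavesS c₁) (leavesS c₂)
                          (leafCountS c₁ c₂ (∷-injectiveˡ sh)) eq
    in cong₂ _∷_ (sub-determined c₁ c₂ (∷-injectiveˡ sh) same₁)
                 (forest-determined cs₁ cs₂ (∷-injectiveʳ sh) same₂)

-- Step 1: the contour word determines the shape.

data Branching : Sub → Set where
  branch-leaf : ∀ {ℓ} → Branching (leaf ℓ)
  branch-node : ∀ {c cs} → All Branching (c ∷ cs) → Branching (node (c ∷ cs))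

-- Condition (2) gives every internal vertex a descendant leaf, hence a child.
mutual
  decS-branching : ∀ {e} c → DecS e c → Branching c
  decS-branching (leaf _) _ = branch-leaf
  decS-branching (node (c ∷ cs)) (_ , _ , decs) = branch-node (decL-branching (c ∷ cs) decs)

  decL-branching : ∀ {e} cs → DecL e cs → All Branching cs
  decL-branching [] _ = []
  decL-branching (c ∷ cs) (dec , decs) = decS-branching c dec ∷ decL-branching cs decs

NoLeading : Letter → List Letter → Set
NoLeading a [] = ⊤
NoLeading a (b ∷ _) = ¬ (a ≡ b)

contour-node : ∀ cs s → contourS (node cs) ++ s ≡ u ∷ (contourL cs ++ d ∷ s)
contour-node cs s = cong (u ∷_) (++-assoc (contourL cs) (d ∷ []) s)

contour-leading-u : ∀ c cs r → ¬ NoLeading u (contourL (c ∷ cs) ++ r)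
contour-leading-u c cs r nl with subst (NoLeading u) (++-assoc (contourS c) (contourL cs) r) nl
contour-leading-u (leaf _) cs r nl | nl′ = nl′ refl
contour-leading-u (node _) cs r nl | nl′ = nl′ refl

-- Parsing: a contour followed by a word not beginning with u determines the
-- shape and the remaining word (each subtree's contour ends where its d's
-- balance its u's, and a leaf ud is distinguished from an internal vertex
-- since the latter has a child).
mutual
  contour-shapeS : ∀ {c₁ c₂} s₁ s₂ → Branching c₁ → Branching c₂ →
    contourS c₁ ++ s₁ ≡ contourS c₂ ++ s₂ → shapeS c₁ ≡ shapeS c₂ × s₁ ≡ s₂
  contour-shapeS s₁ s₂ branch-leaf branch-leaf eq = refl , ∷-injectiveʳ (∷-injectiveʳ eq)
  contour-shapeS {_} {node (c ∷ cs)} s₁ s₂ branch-leaf (branch-node _) eq =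
    ⊥-elim (contour-leading-u c cs (d ∷ s₂) (subst (NoLeading u) (∷-injectiveʳ (trans eq (contour-node (c ∷ cs) s₂))) λ ()))
  contour-shapeS {node (c ∷ cs)} {_} s₁ s₂ (branch-node _) branch-leaf eq =
    ⊥-elim (contour-leading-u c cs (d ∷ s₁) (subst (NoLeading u) (∷-injectiveʳ (trans (sym eq) (contour-node (c ∷ cs) s₁))) λ ()))
  contour-shapeS {node cs₁} {node cs₂} s₁ s₂ (branch-node bs₁) (branch-node bs₂) eq =
    let sh , rest = contour-shapeL (d ∷ s₁) (d ∷ s₂) bs₁ bs₂ (λ ()) (λ ())
                      (∷-injectiveʳ (trans (sym (contour-node cs₁ s₁)) (trans eq (contour-node cs₂ s₂))))
    in cong snode sh , ∷-injectiveʳ rest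

  contour-shapeL : ∀ {cs₁ cs₂} r₁ r₂ → All Branching cs₁ → All Branching cs₂ →
    NoLeading u r₁ → NoLeading u r₂ →
    contourL cs₁ ++ r₁ ≡ contourL cs₂ ++ r₂ → shapeL cs₁ ≡ shapeL cs₂ × r₁ ≡ r₂
  contour-shapeL r₁ r₂ [] [] _ _ eq = refl , eq
  contour-shapeL {_} {c ∷ cs} r₁ r₂ [] (_ ∷ _) nl₁ _ eq =
    ⊥-elim (contour-leading-u c cs r₂ (subst (NoLeading u) eq nl₁))
  contour-shapeL {c ∷ cs} {_} r₁ r₂ (_ ∷ _) [] _ nl₂ eq =
    ⊥-elim (contour-leading-u c cs r₁ (subst (NoLeading u) (sym eq) nl₂))
  contour-shapeL {c₁ ∷ cs₁} {c₂ ∷ cs₂} r₁ r₂ (b₁ ∷ bs₁) (b₂ ∷ bs₂) nl₁ nl₂ eq =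
    let sh , rest = contour-shapeS (contourL cs₁ ++ r₁) (contourL cs₂ ++ r₂) b₁ b₂
                      (trans (sym (++-assoc (contourS c₁) (contourL cs₁) r₁))
                             (trans eq (++-assoc (contourS c₂) (contourL cs₂) r₂)))
        sh′ , r₁≡r₂ = contour-shapeL r₁ r₂ bs₁ bs₂ nl₁ nl₂ rest
    in cong₂ _∷_ sh sh′ , r₁≡r₂

Q-determines-shape : ∀ {T₁ T₂} → Decorated T₁ → Decorated T₂ → Q T₁ ≡ Q T₂ → shapeL T₁ ≡ shapeL T₂
Q-determines-shape {T₁} {T₂} (_ , decs₁) (_ , decs₂) eq =
  proj₁ (contour-shapeL [] [] (decL-branching T₁ decs₁) (decL-branching T₂ decs₂) _ _
          (trans (++-identityʳ (Q T₁)) (trans eq (sym (++-identityʳ (Q T₂))))))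

mutual
  flatS : CSub → List (ℤ × ℕ)
  flatS (cleaf ℓ k) = (ℓ , k) ∷ []
  flatS (cnode cs) = flatL cs

  flatL : List CSub → List (ℤ × ℕ)
  flatL [] = []
  flatL (c ∷ cs) = flatS c ++ flatL cs

labels : List (ℤ × ℕ) → List ℤ
labels = map proj₁

charges : List (ℤ × ℕ) → List ℕ
charges = map proj₂

bumpList : (ℤ → Bool) → List (ℤ × ℕ) → List (ℤ × ℕ)
bumpList φ [] = []
bumpList φ ((ℓ , k) ∷ r) = if φ ℓ then (ℓ , suc k) ∷ r else (ℓ , k) ∷ bumpList φ r

-- bumpL acts on leaf sequences as bumpList; its flag tells whether the bump
-- already happened, i.e. whether a continuation r is still to be bumped.
mutual
  bumpS-flat : ∀ φ c r →
    flatS (proj₁ (bumpS φ c)) ++ (if proj₂ (bumpS φ c) then r else bumpList φ r) ≡ bumpList φ (flatS c ++ r)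
  bumpS-flat φ (cleaf ℓ k) r with φ ℓ
  ... | true = refl
  ... | false = refl
  bumpS-flat φ (cnode cs) r with bumpL φ cs | bumpL-flat φ cs r
  ... | cs′ , b | eq = eq

  bumpL-flat : ∀ φ cs r →
    flatL (proj₁ (bumpL φ cs)) ++ (if proj₂ (bumpL φ cs) then r else bumpList φ r) ≡ bumpList φ (flatL cs ++ r)
  bumpL-flat φ [] r = refl
  bumpL-flat φ (c ∷ cs) r with bumpS φ c | bumpS-flat φ c (flatL cs ++ r)
  ... | c′ , true | eq = begin
    (flatS c′ ++ flatL cs) ++ r   ≡⟨ ++-assoc (flatS c′) (flatL cs) r ⟩
    flatS c′ ++ flatL cs ++ r     ≡⟨ eq ⟩
    bumpList φ (flatS c ++ flatL cs ++ r)   ≡⟨ cong (bumpList φ) (++-assoc (flatS c) (flatL cs) r) ⟨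
    bumpList φ ((flatS c ++ flatL cs) ++ r) ∎
  ... | c′ , false | eq with bumpL φ cs | bumpL-flat φ cs r
  ...   | cs′ , b | eq′ = begin
    (flatS c′ ++ flatL cs′) ++ _  ≡⟨ ++-assoc (flatS c′) (flatL cs′) _ ⟩
    flatS c′ ++ flatL cs′ ++ _    ≡⟨ cong (flatS c′ ++_) eq′ ⟩
    flatS c′ ++ bumpList φ (flatL cs ++ r)  ≡⟨ eq ⟩
    bumpList φ (flatS c ++ flatL cs ++ r)   ≡⟨ cong (bumpList φ) (++-assoc (flatS c) (flatL cs) r) ⟨
    bumpList φ ((flatS c ++ flatL cs) ++ r) ∎

atMost : ℤ → ℤ → Bool
atMost t ℓ = ⌊ ℓ ≤? t ⌋

eligible : ℕ → ℤ → Bool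
eligible p = atMost ((+ p) - (+ 2))

charge-flat : ∀ p cs → flatS (chargeS p (node cs)) ≡ bumpList (eligible p) (flatL (chargeL (suc p) cs))
charge-flat p cs with bumpL (λ ℓ → ⌊ ℓ ≤? (+ p) - (+ 2) ⌋) (chargeL (suc p) cs)
                    | bumpL-flat (eligible p) (chargeL (suc p) cs) []
... | cs′ , b | eq = begin
  flatL cs′                                          ≡⟨ ++-identityʳ (flatL cs′) ⟨
  flatL cs′ ++ []                                    ≡⟨ cong (flatL cs′ ++_) (if-nil b) ⟨
  flatL cs′ ++ (if b then [] else bumpList (eligible p) []) ≡⟨ eq ⟩
  bumpList (eligible p) (flatL (chargeL (suc p) cs) ++ [])  ≡⟨ cong (bumpList (eligible p)) (++-identityʳ (flatL (chargeL (suc p) cs))) ⟩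
  bumpList (eligible p) (flatL (chargeL (suc p) cs))        ∎
  where
  if-nil : ∀ b → (if b then [] else bumpList (eligible p) []) ≡ []
  if-nil true = refl
  if-nil false = refl

labels-bump : ∀ φ F → labels (bumpList φ F) ≡ labels F
labels-bump φ [] = refl
labels-bump φ ((ℓ , k) ∷ F) with φ ℓ
... | true = refl
... | false = cong (ℓ ∷_) (labels-bump φ F)

mutual
  bumpS-shape : ∀ φ c → cshapeS (proj₁ (bumpS φ c)) ≡ cshapeS c
  bumpS-shape φ (cleaf ℓ k) with φ ℓ
  ... | true = refl
  ... | false = refl
  bumpS-shape φ (cnode cs) with bumpL φ cs | bumpL-shape φ cs
  ... | cs′ , b | eq = cong snode eq

  bumpL-shape : ∀ φ cs → cshapeL (proj₁ (bumpL φ cs)) ≡ cshapeL cs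
  bumpL-shape φ [] = refl
  bumpL-shape φ (c ∷ cs) with bumpS φ c | bumpS-shape φ c
  ... | c′ , true | eq = cong (_∷ cshapeL cs) eq
  ... | c′ , false | eq with bumpL φ cs | bumpL-shape φ cs
  ...   | cs′ , b | eq′ = cong₂ _∷_ eq eq′

mutual
  charge-labelsS : ∀ p c → labels (flatS (chargeS p c)) ≡ leavesS c
  charge-labelsS p (leaf ℓ) = refl
  charge-labelsS p (node cs) = begin
    labels (flatS (chargeS p (node cs)))                          ≡⟨ cong labels (charge-flat p cs) ⟩
    labels (bumpList (eligible p) (flatL (chargeL (suc p) cs)))   ≡⟨ labels-bump (eligible p) _ ⟩
    labels (flatL (chargeL (suc p) cs))                           ≡⟨ charge-labelsL (suc p) cs ⟩
    leavesL cs                                                    ∎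

  charge-labelsL : ∀ p cs → labels (flatL (chargeL p cs)) ≡ leavesL cs
  charge-labelsL p [] = refl
  charge-labelsL p (c ∷ cs) = trans (map-++ proj₁ (flatS (chargeS p c)) (flatL (chargeL p cs)))
                                    (cong₂ _++_ (charge-labelsS p c) (charge-labelsL p cs))

mutual
  charge-shapeS : ∀ p c → cshapeS (chargeS p c) ≡ shapeS c
  charge-shapeS p (leaf ℓ) = refl
  charge-shapeS p (node cs) with bumpL (λ ℓ → ⌊ ℓ ≤? (+ p) - (+ 2) ⌋) (chargeL (suc p) cs)
                               | bumpL-shape (eligible p) (chargeL (suc p) cs)
  ... | cs′ , b | eq = cong snode (trans eq (charge-shapeL (suc p) cs))

  charge-shapeL : ∀ p cs → cshapeL (chargeL p cs) ≡ shapeL cs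
  charge-shapeL p [] = refl
  charge-shapeL p (c ∷ cs) = cong₂ _∷_ (charge-shapeS p c) (charge-shapeL p cs)

-- Step 2: given the shape, P determines the charges.

replicate-d-cancel : ∀ k₁ k₂ {s₁ s₂} → NoLeading d s₁ → NoLeading d s₂ →
  replicate k₁ d ++ s₁ ≡ replicate k₂ d ++ s₂ → k₁ ≡ k₂ × s₁ ≡ s₂
replicate-d-cancel zero zero _ _ eq = refl , eq
replicate-d-cancel zero (suc k₂) nl₁ _ eq = ⊥-elim (subst (NoLeading d) eq nl₁ refl)
replicate-d-cancel (suc k₁) zero _ nl₂ eq = ⊥-elim (subst (NoLeading d) (sym eq) nl₂ refl)
replicate-d-cancel (suc k₁) (suc k₂) nl₁ nl₂ eq =
  let k₁≡k₂ , s₁≡s₂ = replicate-d-cancel k₁ k₂ nl₁ nl₂ (∷-injectiveʳ eq) in cong suc k₁≡k₂ , s₁≡s₂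

pword-leading-u : ∀ C r → NoLeading d r → NoLeading d (pwordL C ++ r)
pword-leading-u [] r nl = nl
pword-leading-u (cleaf _ _ ∷ C) r nl = λ ()
pword-leading-u (cnode _ ∷ C) r nl = λ ()

-- Parsing P against a known shape: each leaf u d^(1+k) is delimited by the
-- next u (or the end), so its charge k is read off.
mutual
  pword-chargesS : ∀ c₁ c₂ {s₁ s₂} → cshapeS c₁ ≡ cshapeS c₂ → NoLeading d s₁ → NoLeading d s₂ →
    pwordS c₁ ++ s₁ ≡ pwordS c₂ ++ s₂ → charges (flatS c₁) ≡ charges (flatS c₂) × s₁ ≡ s₂
  pword-chargesS (cleaf _ k₁) (cleaf _ k₂) _ nl₁ nl₂ eq =
    let k₁≡k₂ , s₁≡s₂ = replicate-d-cancel (suc k₁) (suc k₂) nl₁ nl₂ (∷-injectiveʳ eq)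
    in cong (_∷ []) (ℕP.suc-injective k₁≡k₂) , s₁≡s₂
  pword-chargesS (cnode C₁) (cnode C₂) sh nl₁ nl₂ eq =
    pword-chargesL C₁ C₂ (snode-injective sh) nl₁ nl₂ (∷-injectiveʳ eq)

  pword-chargesL : ∀ C₁ C₂ {r₁ r₂} → cshapeL C₁ ≡ cshapeL C₂ → NoLeading d r₁ → NoLeading d r₂ →
    pwordL C₁ ++ r₁ ≡ pwordL C₂ ++ r₂ → charges (flatL C₁) ≡ charges (flatL C₂) × r₁ ≡ r₂
  pword-chargesL [] [] _ _ _ eq = refl , eq
  pword-chargesL (c₁ ∷ C₁) (c₂ ∷ C₂) {r₁} {r₂} sh nl₁ nl₂ eq =
    let head≡ , rest = pword-chargesS c₁ c₂ (∷-injectiveˡ sh) (pword-leading-u C₁ r₁ nl₁) (pword-leading-u C₂ r₂ nl₂)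
                         (trans (sym (++-assoc (pwordS c₁) (pwordL C₁) r₁))
                                (trans eq (++-assoc (pwordS c₂) (pwordL C₂) r₂)))
        tail≡ , r₁≡r₂ = pword-chargesL C₁ C₂ (∷-injectiveʳ sh) nl₁ nl₂ rest
    in (begin
      charges (flatS c₁ ++ flatL C₁)               ≡⟨ map-++ proj₂ (flatS c₁) (flatL C₁) ⟩
      charges (flatS c₁) ++ charges (flatL C₁)     ≡⟨ cong₂ _++_ head≡ tail≡ ⟩
      charges (flatS c₂) ++ charges (flatL C₂)     ≡⟨ map-++ proj₂ (flatS c₂) (flatL C₂) ⟨
      charges (flatS c₂ ++ flatL C₂)               ∎)
    , r₁≡r₂

leafCharges : LTree → List ℕ
leafCharges T = charges (flatL (chargeL 1 T))

P-determines-charges : ∀ T₁ T₂ → shapeL T₁ ≡ shapeL T₂ → P T₁ ≡ P T₂ → leafCharges T₁ ≡ leafCharges T₂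
P-determines-charges T₁ T₂ sh eq =
  proj₁ (pword-chargesL (chargeL 1 T₁) (chargeL 1 T₂)
          (trans (charge-shapeL 1 T₁) (trans sh (sym (charge-shapeL 1 T₂)))) _ _
          (trans (++-identityʳ (P T₁)) (trans eq (sym (++-identityʳ (P T₂))))))

-- Step 3: dominance of charges at the first differing leaf.

record Focus (L : List ℤ) (x : ℤ) (k : ℕ) (F : List (ℤ × ℕ)) : Set where
  constructor focus
  field
    before after : List (ℤ × ℕ)
    split : F ≡ before ++ (x , k) ∷ after
    labels-before : labels before ≡ L

focus-++ʳ : ∀ {L x k F} G → Focus L x k F → Focus L x k (F ++ G)
focus-++ʳ {x = x} {k} G (focus A B refl lab) = focus A (B ++ G) (++-assoc A ((x , k) ∷ B) G) lab

focus-++ˡ : ∀ {L x k F} H {M} → labels H ≡ M → Focus L x k F → Focus (M ++ L) x k (H ++ F)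
focus-++ˡ {x = x} {k} H refl (focus A B refl refl) =
  focus (H ++ A) B (sym (++-assoc H A ((x , k) ∷ B))) (map-++ proj₁ H A)

-- Entries with equal label prefixes sit at the same position, so equal charge
-- sequences give them equal charges.
focus-charges : ∀ {L x₁ x₂ k₁ k₂ F₁ F₂} → Focus L x₁ k₁ F₁ → Focus L x₂ k₂ F₂ →
  charges F₁ ≡ charges F₂ → k₁ ≡ k₂
focus-charges {x₁ = x₁} {x₂} {k₁} {k₂} (focus A₁ B₁ refl refl) (focus A₂ B₂ refl lab₂) eq =
  ∷-injectiveˡ (proj₂ (++-cancel-length (charges A₁) (charges A₂) same-length charges-split))
  where
  same-length : length (charges A₁) ≡ length (charges A₂)
  same-length = begin
    length (charges A₁)  ≡⟨ length-map proj₂ A₁ ⟩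
    length A₁            ≡⟨ length-map proj₁ A₁ ⟨
    length (labels A₁)   ≡⟨ cong length lab₂ ⟨
    length (labels A₂)   ≡⟨ length-map proj₁ A₂ ⟩
    length A₂            ≡⟨ length-map proj₂ A₂ ⟨
    length (charges A₂)  ∎
  charges-split : charges A₁ ++ k₁ ∷ charges B₁ ≡ charges A₂ ++ k₂ ∷ charges B₂
  charges-split = begin
    charges A₁ ++ k₁ ∷ charges B₁     ≡⟨ map-++ proj₂ A₁ ((x₁ , k₁) ∷ B₁) ⟨
    charges (A₁ ++ (x₁ , k₁) ∷ B₁)    ≡⟨ eq ⟩
    charges (A₂ ++ (x₂ , k₂) ∷ B₂)    ≡⟨ map-++ proj₂ A₂ ((x₂ , k₂) ∷ B₂) ⟩
    charges A₂ ++ k₂ ∷ charges B₂     ∎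

-- The charge a bump adds to the entry after a prefix labelled L, the entry
-- being labelled x: 1 if φ holds for x but for no label of L, else 0.
hitCount : (ℤ → Bool) → List ℤ → ℤ → ℕ
hitCount φ [] x = if φ x then 1 else 0
hitCount φ (y ∷ L) x = if φ y then 0 else hitCount φ L x

bump-focus : ∀ φ A x k B →
  Focus (labels A) x (hitCount φ (labels A) x ℕ.+ k) (bumpList φ (A ++ (x , k) ∷ B))
bump-focus φ [] x k B with φ x
... | true = focus [] B refl refl
... | false = focus [] (bumpList φ B) refl refl
bump-focus φ ((y , j) ∷ A) x k B with φ y
... | true = focus ((y , suc j) ∷ A) B refl refl
... | false = focus-++ˡ ((y , j) ∷ []) refl (bump-focus φ A x k B)

focus-bump : ∀ φ {L x k F} → Focus L x k F → Focus L x (hitCount φ L x ℕ.+ k) (bumpList φ F)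
focus-bump φ {x = x} {k} (focus A B refl refl) = bump-focus φ A x k B

hit-antitone : ∀ t L {x₁ x₂} → x₁ ≤ x₂ → hitCount (atMost t) L x₂ ℕ.≤ hitCount (atMost t) L x₁
hit-antitone t [] {x₁} {x₂} x₁≤x₂ with x₂ ≤? t | x₁ ≤? t
... | yes _ | yes _ = ℕP.≤-refl
... | yes x₂≤t | no x₁≰t = ⊥-elim (x₁≰t (ℤP.≤-trans x₁≤x₂ x₂≤t))
... | no _ | _ = z≤n
hit-antitone t (y ∷ L) x₁≤x₂ with y ≤? t
... | yes _ = ℕP.≤-refl
... | no _ = hit-antitone t L x₁≤x₂

hit-above : ∀ t L {x} → ¬ (x ≤ t) → hitCount (atMost t) L x ≡ 0
hit-above t [] {x} x≰t with x ≤? t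
... | yes x≤t = ⊥-elim (x≰t x≤t)
... | no _ = refl
hit-above t (y ∷ L) x≰t with y ≤? t
... | yes _ = refl
... | no _ = hit-above t L x≰t

hit-first : ∀ t L {x} → All (λ ℓ → ¬ (ℓ ≤ t)) L → x ≤ t → hitCount (atMost t) L x ≡ 1
hit-first t [] {x} [] x≤t with x ≤? t
... | yes _ = refl
... | no x≰t = ⊥-elim (x≰t x≤t)
hit-first t (y ∷ L) (y≰t ∷ L≰t) x≤t with y ≤? t
... | yes y≤t = ⊥-elim (y≰t y≤t)
... | no _ = hit-first t L L≰t x≤t

threshold : ∀ q → (+ suc q) - (+ 2) ≡ ℤ.pred (+ q)
threshold zero = refl
threshold (suc q) = refl

eligible⇒< : ∀ q {ℓ} → ℓ ≤ (+ suc q) - (+ 2) → ℓ < + q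
eligible⇒< q ℓ≤t = ℤP.i≤pred[j]⇒i<j (subst (_ ≤_) (threshold q) ℓ≤t)

<⇒eligible : ∀ q {ℓ} → ℓ < + q → ℓ ≤ (+ suc q) - (+ 2)
<⇒eligible q ℓ<q = subst (_ ≤_) (sym (threshold q)) (ℤP.i<j⇒i≤pred[j] ℓ<q)

-- The invariant for a subtree hanging from a vertex of depth q: the leaf with
-- the smaller label x₁ has at least the charge of the one labelled x₂, and
-- strictly more as soon as x₂ ≥ q.
Dominates : ℕ → ℤ → ℕ → ℕ → Set
Dominates q x₂ k₁ k₂ = k₂ ℕ.≤ k₁ × (+ q ≤ x₂ → k₂ ℕ.< k₁)

-- Charging a vertex of depth q + 1 moves the invariant from level q + 1 to q.
-- The new strict case x₂ = q uses condition (3): then no leaf before the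
-- difference is eligible, while x₁ < q is.
dominates-charge : ∀ q L {x₁ x₂ k₁ k₂} → x₁ < x₂ → (x₂ ≡ + q → All (+ q ≤_) L) →
  Dominates (suc q) x₂ k₁ k₂ →
  Dominates q x₂ (hitCount (eligible (suc q)) L x₁ ℕ.+ k₁) (hitCount (eligible (suc q)) L x₂ ℕ.+ k₂)
dominates-charge q L {x₁} {x₂} {k₁} {k₂} x₁<x₂ prefix (k₂≤k₁ , strict) =
  ℕP.+-mono-≤ (hit-antitone t L (ℤP.<⇒≤ x₁<x₂)) k₂≤k₁ , strict′
  where
  t : ℤ
  t = (+ suc q) - (+ 2)
  strict′ : + q ≤ x₂ → hitCount (atMost t) L x₂ ℕ.+ k₂ ℕ.< hitCount (atMost t) L x₁ ℕ.+ k₁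
  strict′ q≤x₂ rewrite hit-above t L (λ x₂≤t → ℤP.<⇒≱ (eligible⇒< q x₂≤t) q≤x₂) with x₂ ≟ + q
  ... | no x₂≢q = ℕP.≤-trans (strict (ℤP.i<j⇒suc[i]≤j (ℤP.≤∧≢⇒< q≤x₂ (x₂≢q ∘ sym)))) (ℕP.m≤n+m k₁ _)
  ... | yes refl rewrite hit-first t L (All.map (λ q≤ℓ ℓ≤t → ℤP.<⇒≱ (eligible⇒< q ℓ≤t) q≤ℓ) (prefix refl))
                                       (<⇒eligible q x₁<x₂) = s≤s k₂≤k₁

record Diverge (q : ℕ) (L : List ℤ) (x₁ x₂ : ℤ) (F₁ F₂ : List (ℤ × ℕ)) : Set where
  constructor diverge
  field
    {k₁ k₂} : ℕ
    focus₁ : Focus L x₁ k₁ F₁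
    focus₂ : Focus L x₂ k₂ F₂
    dominates : Dominates q x₂ k₁ k₂

diverge-++ʳ : ∀ {q L x₁ x₂ F₁ F₂} G₁ G₂ → Diverge q L x₁ x₂ F₁ F₂ → Diverge q L x₁ x₂ (F₁ ++ G₁) (F₂ ++ G₂)
diverge-++ʳ G₁ G₂ (diverge f₁ f₂ dom) = diverge (focus-++ʳ G₁ f₁) (focus-++ʳ G₂ f₂) dom

diverge-++ˡ : ∀ {q L x₁ x₂ F₁ F₂ M} H₁ H₂ → labels H₁ ≡ M → labels H₂ ≡ M →
  Diverge q L x₁ x₂ F₁ F₂ → Diverge q (M ++ L) x₁ x₂ (H₁ ++ F₁) (H₂ ++ F₂)
diverge-++ˡ H₁ H₂ lab₁ lab₂ (diverge f₁ f₂ dom) = diverge (focus-++ˡ H₁ lab₁ f₁) (focus-++ˡ H₂ lab₂ f₂) dom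

diverge-charge : ∀ {q L x₁ x₂ F₁ F₂} → x₁ < x₂ → (x₂ ≡ + q → All (+ q ≤_) L) →
  Diverge (suc q) L x₁ x₂ F₁ F₂ →
  Diverge q L x₁ x₂ (bumpList (eligible (suc q)) F₁) (bumpList (eligible (suc q)) F₂)
diverge-charge {q} {L} x₁<x₂ prefix (diverge f₁ f₂ dom) =
  diverge (focus-bump (eligible (suc q)) f₁) (focus-bump (eligible (suc q)) f₂) (dominates-charge q L x₁<x₂ prefix dom)

locate : ∀ {A : Set} (a₁ b₁ a₂ b₂ L : List A) {x₁ x₂ : A} {R₁ R₂ : List A} → length a₁ ≡ length a₂ →
  a₁ ++ b₁ ≡ L ++ x₁ ∷ R₁ → a₂ ++ b₂ ≡ L ++ x₂ ∷ R₂ →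
  (Σ (List A) λ R₁′ → Σ (List A) λ R₂′ → a₁ ≡ L ++ x₁ ∷ R₁′ × a₂ ≡ L ++ x₂ ∷ R₂′)
  ⊎ (Σ (List A) λ L′ → L ≡ a₁ ++ L′ × a₁ ≡ a₂ × b₁ ≡ L′ ++ x₁ ∷ R₁ × b₂ ≡ L′ ++ x₂ ∷ R₂)
locate [] b₁ [] b₂ L _ e₁ e₂ = inj₂ (L , refl , refl , e₁ , e₂)
locate (y₁ ∷ a₁) b₁ (y₂ ∷ a₂) b₂ [] _ e₁ e₂ =
  inj₁ (a₁ , a₂ , cong (_∷ a₁) (∷-injectiveˡ e₁) , cong (_∷ a₂) (∷-injectiveˡ e₂))
locate (y₁ ∷ a₁) b₁ (y₂ ∷ a₂) b₂ (z ∷ L) len e₁ e₂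
  with locate a₁ b₁ a₂ b₂ L (ℕP.suc-injective len) (∷-injectiveʳ e₁) (∷-injectiveʳ e₂)
... | inj₁ (R₁′ , R₂′ , p₁ , p₂) =
  inj₁ (R₁′ , R₂′ , cong₂ _∷_ (∷-injectiveˡ e₁) p₁ , cong₂ _∷_ (∷-injectiveˡ e₂) p₂)
... | inj₂ (L′ , L≡ , a₁≡a₂ , p₁ , p₂) =
  inj₂ (L′ , cong₂ _∷_ (sym (∷-injectiveˡ e₁)) L≡ ,
        cong₂ _∷_ (trans (∷-injectiveˡ e₁) (sym (∷-injectiveˡ e₂))) a₁≡a₂ , p₁ , p₂)

-- At a
-- leaf this holds since condition (1) gives x₂ < q; at an internal vertex by
-- induction and dominates-charge.
mutual
  dominanceS : ∀ q c₁ c₂ L {x₁ x₂ R₁ R₂} → shapeS c₁ ≡ shapeS c₂ → DecS (suc q) c₂ →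
    PrefixCond (+ q) (leavesS c₂) → leavesS c₁ ≡ L ++ x₁ ∷ R₁ → leavesS c₂ ≡ L ++ x₂ ∷ R₂ → x₁ < x₂ →
    Diverge q L x₁ x₂ (flatS (chargeS (suc q) c₁)) (flatS (chargeS (suc q) c₂))
  dominanceS q (leaf _) (leaf _) [] _ (_ , x₂<q) _ refl refl _ =
    diverge (focus [] [] refl refl) (focus [] [] refl refl) (z≤n , λ q≤x₂ → ⊥-elim (ℤP.<⇒≱ x₂<q q≤x₂))
  dominanceS q (leaf _) (leaf _) (_ ∷ L) _ _ _ e₁ _ _ = ⊥-elim ([]≢++∷ L (∷-injectiveʳ e₁))
  dominanceS q (node cs₁) (node cs₂) L sh (_ , prefixes , decs) prefix e₁ e₂ x₁<x₂ =
    subst₂ (Diverge q L _ _) (sym (charge-flat (suc q) cs₁)) (sym (charge-flat (suc q) cs₂))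
      (diverge-charge x₁<x₂ (prefix L _ _ e₂)
        (dominanceL (suc q) cs₁ cs₂ L (snode-injective sh) decs prefixes e₁ e₂ x₁<x₂))

  dominanceL : ∀ q cs₁ cs₂ L {x₁ x₂ R₁ R₂} → shapeL cs₁ ≡ shapeL cs₂ → DecL (suc q) cs₂ →
    All (λ c → PrefixCond (+ q) (leavesS c)) cs₂ →
    leavesL cs₁ ≡ L ++ x₁ ∷ R₁ → leavesL cs₂ ≡ L ++ x₂ ∷ R₂ → x₁ < x₂ →
    Diverge q L x₁ x₂ (flatL (chargeL (suc q) cs₁)) (flatL (chargeL (suc q) cs₂))
  dominanceL q [] [] L _ _ _ e₁ _ _ = ⊥-elim ([]≢++∷ L e₁)
  dominanceL q (c₁ ∷ cs₁) (c₂ ∷ cs₂) L sh (dec , decs) (prefix ∷ prefixes) e₁ e₂ x₁<x₂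
    with locate (leavesS c₁) (leavesL cs₁) (leavesS c₂) (leavesL cs₂) L
                (leafCountS c₁ c₂ (∷-injectiveˡ sh)) e₁ e₂
  ... | inj₁ (_ , _ , e₁′ , e₂′) =
    diverge-++ʳ _ _ (dominanceS q c₁ c₂ L (∷-injectiveˡ sh) dec prefix e₁′ e₂′ x₁<x₂)
  ... | inj₂ (L′ , L≡ , same , e₁′ , e₂′) =
    subst (λ M → Diverge q M _ _ _ _) (sym L≡)
      (diverge-++ˡ (flatS (chargeS (suc q) c₁)) (flatS (chargeS (suc q) c₂))
        (charge-labelsS (suc q) c₁) (trans (charge-labelsS (suc q) c₂) (sym same))
        (dominanceL q cs₁ cs₂ L′ (∷-injectiveʳ sh) decs prefixes e₁′ e₂′ x₁<x₂))

-- Step 4: the leaf words coincide.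

mutual
  labels-≥-1S : ∀ {e} c → DecS e c → All (-[1+ 0 ] ≤_) (leavesS c)
  labels-≥-1S (leaf _) (-1≤ℓ , _) = -1≤ℓ ∷ []
  labels-≥-1S (node cs) (_ , _ , decs) = labels-≥-1L cs decs

  labels-≥-1L : ∀ {e} cs → DecL e cs → All (-[1+ 0 ] ≤_) (leavesL cs)
  labels-≥-1L [] _ = []
  labels-≥-1L (c ∷ cs) (dec , decs) = AllP.++⁺ (labels-≥-1S c dec) (labels-≥-1L cs decs)

record Diverges (l₁ l₂ : List ℤ) : Set where
  constructor diverges
  field
    common : List ℤ
    {x₁ x₂} : ℤ
    {rest₁ rest₂} : List ℤ
    smaller : x₁ < x₂
    split₁ : l₁ ≡ common ++ x₁ ∷ rest₁
    split₂ : l₂ ≡ common ++ x₂ ∷ rest₂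

diverges-∷ : ∀ x {l₁ l₂} → Diverges l₁ l₂ → Diverges (x ∷ l₁) (x ∷ l₂)
diverges-∷ x (diverges L lt e₁ e₂) = diverges (x ∷ L) lt (cong (x ∷_) e₁) (cong (x ∷_) e₂)

compare-words : ∀ l₁ l₂ → length l₁ ≡ length l₂ → l₁ ≡ l₂ ⊎ Diverges l₁ l₂ ⊎ Diverges l₂ l₁
compare-words [] [] _ = inj₁ refl
compare-words (x ∷ l₁) (y ∷ l₂) len with ℤP.<-cmp x y
... | tri< x<y _ _ = inj₂ (inj₁ (diverges [] x<y refl refl))
... | tri> _ _ y<x = inj₂ (inj₂ (diverges [] y<x refl refl))
... | tri≈ _ refl _ with compare-words l₁ l₂ (ℕP.suc-injective len)
...   | inj₁ eq = inj₁ (cong (x ∷_) eq)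
...   | inj₂ (inj₁ δ) = inj₂ (inj₁ (diverges-∷ x δ))
...   | inj₂ (inj₂ δ) = inj₂ (inj₂ (diverges-∷ x δ))

-- At the root (q = 0) the larger label x₂ > x₁ ≥ -1 is ≥ 0, so the charges
-- at the first difference would differ.
no-divergence : ∀ {T₁ T₂} → Decorated T₁ → Decorated T₂ → shapeL T₁ ≡ shapeL T₂ →
  leafCharges T₁ ≡ leafCharges T₂ → ¬ Diverges (leavesL T₁) (leavesL T₂)
no-divergence {T₁} {T₂} (_ , decs₁) (prefixes₂ , decs₂) sh ch (diverges L x₁<x₂ e₁ e₂)
  with dominanceL 0 T₁ T₂ L sh decs₂ prefixes₂ e₁ e₂ x₁<x₂
... | diverge f₁ f₂ (_ , strict) = ℕP.<-irrefl (focus-charges f₂ f₁ (sym ch)) (strict 0≤x₂)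
  where
  -1≤x₁ : -[1+ 0 ] ≤ _
  -1≤x₁ = All.head (AllP.++⁻ʳ L (subst (All _) e₁ (labels-≥-1L T₁ decs₁)))
  0≤x₂ : + 0 ≤ _
  0≤x₂ = ℤP.i<j⇒suc[i]≤j (ℤP.≤-<-trans -1≤x₁ x₁<x₂)

charges-determine-labels : ∀ {T₁ T₂} → Decorated T₁ → Decorated T₂ → shapeL T₁ ≡ shapeL T₂ →
  leafCharges T₁ ≡ leafCharges T₂ → leavesL T₁ ≡ leavesL T₂
charges-determine-labels {T₁} {T₂} D₁ D₂ sh ch
  with compare-words (leavesL T₁) (leavesL T₂) (leafCountL T₁ T₂ sh)
... | inj₁ eq = eq
... | inj₂ (inj₁ δ) = ⊥-elim (no-divergence D₁ D₂ sh ch δ)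
... | inj₂ (inj₂ δ) = ⊥-elim (no-divergence D₂ D₁ (sym sh) (sym ch) δ)

proposition10 : (T₁ T₂ : LTree) → Decorated T₁ → Decorated T₂ →
    P T₁ ≡ P T₂ → Q T₁ ≡ Q T₂ → T₁ ≡ T₂
proposition10 T₁ T₂ D₁ D₂ eqP eqQ =
  forest-determined T₁ T₂ sameShape (charges-determine-labels D₁ D₂ sameShape sameCharges)
  where
  sameShape : shapeL T₁ ≡ shapeL T₂
  sameShape = Q-determines-shape D₁ D₂ eqQ
  sameCharges : leafCharges T₁ ≡ leafCharges T₂
  sameCharges = P-determines-charges T₁ T₂ sameShape eqP
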